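{- Let $I=(S,C,T,\mathbf p,\mathbf c)$ be an instance of the DFEP and let $S_1,\dots,S_q$ be a partition of $S$. Then $OPT_E(S)\ge\sum_{j=1}^qOPT_E(S_j)$ and $OPT_W(S)\ge\max_{1\le j\le q}OPT_W(S_j)$, where $OPT_E(S_j)$ and $OPT_W(S_j)$ denote the optimal expected and worst testing costs of the restriction of $I$ to $S_j$.
   Context: DFEP instance: $S$ finite set of objects, $C$ a partition of $S$ into classes, $T$ a finite set of tests $t:S\to\{1,\dots,\ell\}$ (any two distinct objects are distinguished by some test), $\mathbf p$ a probability distribution on $S$, $c(t)\in\mathbb N^+$ test costs. The restriction of $I$ to $S'\subseteq S$ has object set $S'$, classes, probabilities (not renormalized) and costs restricted to $S'$, and the same tests. A decision tree is a leaf labelled with a class if all objects lie in one class; otherwise a root labelled by a test $t$ whose children are decision trees for the nonempty sets $\{s:t(s)=i\}$. $cost(D,s)$ is the total cost of tests on the root-to-leaf path followed by $s$; $OPT_E=\min_D\sum_sp(s)cost(D,s)$, $OPT_W=\min_D\max_scost(D,s)$; $OPT_E(S)=OPT_E(I)$, $OPT_W(S)=OPT_W(I)$.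
   Formalization: The probability distribution $\mathbf p$ on the objects takes values in the rationals. -}

module Defs where

open import Data.Nat as ℕ using (ℕ; zero; suc; _⊔_)
open import Data.Fin using (Fin; zero; suc)
open import Data.Fin.Subset using (Subset; _∈_; inside; outside; Nonempty)
open import Data.Vec using (lookup; tabulate)
open import Data.Bool using (Bool; true; false; if_then_else_)
open import Data.Integer using (+_)
open import Data.Rational using (ℚ; 0ℚ; 1ℚ; _+_; _*_; _/_; _≤_)
open import Data.Product using (Σ; ∃; _×_; _,_)
open import Relation.Binary.PropositionalEquality using (_≡_; _≢_)
open import Relation.Nullary using (¬_)
open import Relation.Nullary.Decidable using (⌊_⌋)
open import Data.Fin.Properties using (_≟_)

sumFin : ∀ {n} → (Fin n → ℚ) → ℚ
sumFin {zero}  f = 0ℚ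
sumFin {suc n} f = f zero + sumFin (λ i → f (suc i))

maxFin : ∀ {n} → (Fin n → ℕ) → ℕ
maxFin {zero}  f = 0
maxFin {suc n} f = f zero ⊔ maxFin (λ i → f (suc i))

toℚ : ℕ → ℚ
toℚ k = (+ k) / 1

-- An instance of the DFEP.  Objects S = Fin n, class labels Fin k,
-- tests indexed by Fin m, test values {1..ℓ} represented by Fin ℓ.
record Instance : Set where
  field
    n k m ℓ     : ℕ
    class       : Fin n → Fin k
    class-onto  : ∀ (c : Fin k) → ∃ λ s → class s ≡ c
    test        : Fin m → Fin n → Fin ℓ
    distinguish : ∀ (s s' : Fin n) → s ≢ s' → ∃ λ t → test t s ≢ test t s'
    prob        : Fin n → ℚ
    prob-nonneg : ∀ s → 0ℚ ≤ prob s
    prob-sum    : sumFin prob ≡ 1ℚ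
    cost        : Fin m → ℕ
    cost-pos    : ∀ t → 1 ℕ.≤ cost t

module _ (I : Instance) where
  open Instance I

  data Tree : Set where
    leaf : Fin k → Tree
    node : Fin m → (Fin ℓ → Tree) → Tree

  branch : Subset n → Fin m → Fin ℓ → Subset n
  branch X t i = tabulate (λ s → if ⌊ test t s ≟ i ⌋ then lookup X s else outside)

  AllIn : Subset n → Fin k → Set
  AllIn X c = ∀ s → s ∈ X → class s ≡ c

  -- D is a decision tree for the restriction of I to X.
  -- (children for empty value-sets are forced to be (irrelevant) leaves,
  -- since the empty set lies vacuously in one class.)
  data IsDT : Subset n → Tree → Set where
    leafDT : ∀ {X c} → AllIn X c → IsDT X (leaf c)
    nodeDT : ∀ {X t ch} → ¬ (∃ λ c → AllIn X c) →
             (∀ i → IsDT (branch X t i) (ch i)) → IsDT X (node t ch)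

  pathCost : Tree → Fin n → ℕ
  pathCost (leaf c)    s = 0
  pathCost (node t ch) s = cost t ℕ.+ pathCost (ch (test t s)) s

  -- Σ_{s ∈ X} p(s) cost(D, s)   (probabilities not renormalised)
  expCost : Subset n → Tree → ℚ
  expCost X D = sumFin (λ s → if lookup X s then prob s * toℚ (pathCost D s) else 0ℚ)

  worstCost : Subset n → Tree → ℕ
  worstCost X D = maxFin (λ s → if lookup X s then pathCost D s else 0)

  IsOPT-E : Subset n → ℚ → Set
  IsOPT-E X v = (∃ λ D → IsDT X D × expCost X D ≡ v)
              × (∀ D → IsDT X D → v ≤ expCost X D)

  IsOPT-W : Subset n → ℕ → Set
  IsOPT-W X w = (∃ λ D → IsDT X D × worstCost X D ≡ w)
              × (∀ D → IsDT X D → w ℕ.≤ worstCost X D)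

  full : Subset n
  full = tabulate (λ _ → inside)

  IsPartition : ∀ {q} → (Fin q → Subset n) → Set
  IsPartition {q} P = (∀ j → Nonempty (P j))
                    × (∀ s → ∃ λ j → s ∈ P j)
                    × (∀ s j j' → s ∈ P j → s ∈ P j' → j ≡ j')

module Submission where

-- A decision tree D for the whole set S can be pruned into a decision
-- tree D' for any subset Y ⊆ S: keep the tests of D, but stop with a leaf as
-- soon as the objects of Y that reach a node all lie in one class.  Every
-- object of Y then follows a prefix of its path in D, so it pays at most what
-- it pays in D.  Hence OPT_E(S_j) ≤ Σ_{s ∈ S_j} p(s) cost(D,s) and
-- OPT_W(S_j) ≤ max_{s ∈ S} cost(D,s) for every part S_j; taking D optimal for
-- S and summing (resp. maximising) over the parts, which split the sum
-- Σ_{s ∈ S} p(s) cost(D,s) exactly, gives the proposition.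

open import Defs
open import Data.Nat using (ℕ)
open import Data.Fin using (Fin)
open import Data.Fin.Subset using (Subset)
open import Data.Rational using (ℚ; _≤_)
open import Data.Product using (_×_)

open import Data.Nat as ℕ using (zero; suc; z≤n)
import Data.Nat.Properties as ℕP
open import Data.Fin using (zero; suc)
open import Data.Fin.Properties using (_≟_; any?; all?; suc-injective)
open import Data.Fin.Subset using (_∈_; _⊆_; outside)
open import Data.Fin.Subset.Properties using (_∈?_)
open import Data.Vec using (lookup)
open import Data.Vec.Properties using ([]=⇒lookup; lookup⇒[]=; lookup∘tabulate)
open import Data.Bool using (true; false; if_then_else_)
import Data.Integer as ℤ
import Data.Integer.Properties as ℤP
open import Data.Rational using (0ℚ; _+_; _*_; mkℚ; *≤*; nonNegative)
import Data.Rational.Properties as ℚP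
open import Algebra.Bundles using (CommutativeMonoid)
open import Algebra.Properties.CommutativeSemigroup
  (CommutativeMonoid.commutativeSemigroup ℚP.+-0-commutativeMonoid) using (interchange)
import Data.Nat.Coprimality as Coprimality
open import Data.Product using (Σ; ∃; _,_; proj₁; proj₂)
open import Relation.Binary.PropositionalEquality
open import Relation.Nullary using (Dec; yes; no)
open import Relation.Nullary.Decidable using (⌊_⌋; _→-dec_)
open import Data.Empty using (⊥-elim)

sumFin-cong : ∀ {n} (f g : Fin n → ℚ) → (∀ i → f i ≡ g i) → sumFin f ≡ sumFin g
sumFin-cong {zero}  f g f≡g = refl
sumFin-cong {suc n} f g f≡g =
  cong₂ _+_ (f≡g zero) (sumFin-cong (λ i → f (suc i)) (λ i → g (suc i)) (λ i → f≡g (suc i)))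

sumFin-mono : ∀ {n} (f g : Fin n → ℚ) → (∀ i → f i ≤ g i) → sumFin f ≤ sumFin g
sumFin-mono {zero}  f g f≤g = ℚP.≤-refl
sumFin-mono {suc n} f g f≤g =
  ℚP.+-mono-≤ (f≤g zero) (sumFin-mono (λ i → f (suc i)) (λ i → g (suc i)) (λ i → f≤g (suc i)))

sumFin-+ : ∀ {n} (f g : Fin n → ℚ) → sumFin (λ i → f i + g i) ≡ sumFin f + sumFin g
sumFin-+ {zero}  f g = refl
sumFin-+ {suc n} f g =
  trans (cong (f zero + g zero +_) (sumFin-+ (λ i → f (suc i)) (λ i → g (suc i))))
        (interchange (f zero) (g zero) _ _)

sumFin-zeros : ∀ {n} (f : Fin n → ℚ) → (∀ i → f i ≡ 0ℚ) → sumFin f ≡ 0ℚ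
sumFin-zeros {zero}  f f≡0 = refl
sumFin-zeros {suc n} f f≡0 =
  trans (cong₂ _+_ (f≡0 zero) (sumFin-zeros (λ i → f (suc i)) (λ i → f≡0 (suc i))))
        (ℚP.+-identityˡ 0ℚ)

sumFin-single : ∀ {n} (f : Fin n → ℚ) (i₀ : Fin n) → (∀ i → i ≢ i₀ → f i ≡ 0ℚ) →
  sumFin f ≡ f i₀
sumFin-single {suc n} f zero f≡0 =
  trans (cong (f zero +_) (sumFin-zeros (λ i → f (suc i)) (λ i → f≡0 (suc i) (λ ()))))
        (ℚP.+-identityʳ (f zero))
sumFin-single {suc n} f (suc i₀) f≡0 =
  trans (cong₂ _+_ (f≡0 zero (λ ()))
                   (sumFin-single (λ i → f (suc i)) i₀ (λ i i≢i₀ → f≡0 (suc i) (λ e → i≢i₀ (suc-injective e)))))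
        (ℚP.+-identityˡ _)

sumFin-swap : ∀ {n m} (g : Fin n → Fin m → ℚ) →
  sumFin (λ i → sumFin (λ j → g i j)) ≡ sumFin (λ j → sumFin (λ i → g i j))
sumFin-swap {zero} {m} g = sym (sumFin-zeros {m} _ (λ _ → refl))
sumFin-swap {suc n} g =
  trans (cong (sumFin (g zero) +_) (sumFin-swap (λ i j → g (suc i) j)))
        (sym (sumFin-+ (g zero) (λ j → sumFin (λ i → g (suc i) j))))

sumFin-partition : ∀ {n q} (P : Fin q → Subset n) →
  (∀ s → ∃ λ j → s ∈ P j) → (∀ s j j' → s ∈ P j → s ∈ P j' → j ≡ j') →
  (a : Fin n → ℚ) →
  sumFin (λ j → sumFin (λ s → if lookup (P j) s then a s else 0ℚ)) ≡ sumFin a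
sumFin-partition P cover disjoint a =
  trans (sumFin-swap restricted) (sumFin-cong _ a column)
  where
  restricted : _ → _ → ℚ
  restricted j s = if lookup (P j) s then a s else 0ℚ

  -- the column of s has a single nonzero entry, in the part containing s
  column : ∀ s → sumFin (λ j → restricted j s) ≡ a s
  column s = trans (sumFin-single (λ j → restricted j s) j₀ elsewhere) at-j₀
    where
    j₀ = proj₁ (cover s)
    at-j₀ : restricted j₀ s ≡ a s
    at-j₀ rewrite []=⇒lookup (proj₂ (cover s)) = refl
    elsewhere : ∀ j → j ≢ j₀ → restricted j s ≡ 0ℚ
    elsewhere j j≢j₀ with lookup (P j) s in s∈Pj
    ... | true  = ⊥-elim (j≢j₀ (disjoint s j j₀ (lookup⇒[]= s (P j) s∈Pj) (proj₂ (cover s))))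
    ... | false = refl

maxFin-lub : ∀ {n} (f : Fin n → ℕ) b → (∀ i → f i ℕ.≤ b) → maxFin f ℕ.≤ b
maxFin-lub {zero}  f b f≤b = z≤n
maxFin-lub {suc n} f b f≤b =
  ℕP.⊔-lub (f≤b zero) (maxFin-lub (λ i → f (suc i)) b (λ i → f≤b (suc i)))

maxFin-mono : ∀ {n} (f g : Fin n → ℕ) → (∀ i → f i ℕ.≤ g i) → maxFin f ℕ.≤ maxFin g
maxFin-mono {zero}  f g f≤g = z≤n
maxFin-mono {suc n} f g f≤g =
  ℕP.⊔-mono-≤ (f≤g zero) (maxFin-mono (λ i → f (suc i)) (λ i → g (suc i)) (λ i → f≤g (suc i)))

toℚ-normal : ∀ a → toℚ a ≡ mkℚ (ℤ.+ a) 0 (Coprimality.sym (Coprimality.1-coprimeTo a))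
toℚ-normal a = ℚP.normalize-coprime (Coprimality.sym (Coprimality.1-coprimeTo a))

toℚ-mono : ∀ {a b} → a ℕ.≤ b → toℚ a ≤ toℚ b
toℚ-mono {a} {b} a≤b rewrite toℚ-normal a | toℚ-normal b =
  *≤* (subst₂ ℤ._≤_ (sym (ℤP.*-identityʳ (ℤ.+ a))) (sym (ℤP.*-identityʳ (ℤ.+ b))) (ℤ.+≤+ a≤b))

module _ (I : Instance) where
  open Instance I

  lookup-branch : ∀ X t i s →
    lookup (branch I X t i) s ≡ (if ⌊ test t s ≟ i ⌋ then lookup X s else outside)
  lookup-branch X t i s = lookup∘tabulate _ s

  branch⁻ : ∀ {X t i s} → s ∈ branch I X t i → s ∈ X
  branch⁻ {X} {t} {i} {s} s∈ =
    member (test t s ≟ i) (trans (sym (lookup-branch X t i s)) ([]=⇒lookup s∈))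
    where
    member : (d : Dec (test t s ≡ i)) → (if ⌊ d ⌋ then lookup X s else outside) ≡ true → s ∈ X
    member (yes _) s∈X = lookup⇒[]= s X s∈X
    member (no _)  ()

  branch-test : ∀ {X t i s} → s ∈ branch I X t i → test t s ≡ i
  branch-test {X} {t} {i} {s} s∈ =
    value (test t s ≟ i) (trans (sym (lookup-branch X t i s)) ([]=⇒lookup s∈))
    where
    value : (d : Dec (test t s ≡ i)) → (if ⌊ d ⌋ then lookup X s else outside) ≡ true → test t s ≡ i
    value (yes ts≡i) _ = ts≡i
    value (no _)     ()

  branch⁺ : ∀ {X t i s} → s ∈ X → test t s ≡ i → s ∈ branch I X t i
  branch⁺ {X} {t} {i} {s} s∈X ts≡i =
    lookup⇒[]= s _ (trans (lookup-branch X t i s) (member (test t s ≟ i)))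
    where
    member : (d : Dec (test t s ≡ i)) → (if ⌊ d ⌋ then lookup X s else outside) ≡ true
    member (yes _)   = []=⇒lookup s∈X
    member (no ts≢i) = ⊥-elim (ts≢i ts≡i)

  branch-mono : ∀ {X Y} t i → Y ⊆ X → branch I Y t i ⊆ branch I X t i
  branch-mono {Y = Y} t i Y⊆X s∈ = branch⁺ (Y⊆X (branch⁻ {Y} s∈)) (branch-test {Y} s∈)

  -- Whether a set lies within one class is decidable (finitely many classes
  -- and objects); pruning needs this to know where to stop.
  oneClass? : (Y : Subset n) → Dec (∃ λ c → AllIn I Y c)
  oneClass? Y = any? (λ c → all? (λ s → (s ∈? Y) →-dec (class s ≟ c)))

  prune : ∀ {X D} → IsDT I X D → ∀ {Y} → Y ⊆ X →
    Σ (Tree I) λ D' → IsDT I Y D' × (∀ s → pathCost I D' s ℕ.≤ pathCost I D s)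
  prune (leafDT {c = c} X⊆c) Y⊆X = leaf c , leafDT (λ s s∈Y → X⊆c s (Y⊆X s∈Y)) , λ s → z≤n
  prune (nodeDT {t = t} {children} _ childDT) {Y} Y⊆X with oneClass? Y
  ... | yes (c , Y⊆c) = leaf c , leafDT Y⊆c , λ s → z≤n
  ... | no  Y-mixed   =
    node t (λ i → proj₁ (pruned i)) ,
    nodeDT Y-mixed (λ i → proj₁ (proj₂ (pruned i))) ,
    λ s → ℕP.+-monoʳ-≤ (cost t) (proj₂ (proj₂ (pruned (test t s))) s)
    where
    pruned : ∀ i → Σ (Tree I) λ D' → IsDT I (branch I Y t i) D' ×
                     (∀ s → pathCost I D' s ℕ.≤ pathCost I (children i) s)
    pruned i = prune (childDT i) (branch-mono t i Y⊆X)

  expCost-mono : ∀ X D' D → (∀ s → pathCost I D' s ℕ.≤ pathCost I D s) →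
    expCost I X D' ≤ expCost I X D
  expCost-mono X D' D D'≤D = sumFin-mono _ _ term
    where
    term : ∀ s → (if lookup X s then prob s * toℚ (pathCost I D' s) else 0ℚ)
               ≤ (if lookup X s then prob s * toℚ (pathCost I D s) else 0ℚ)
    term s with lookup X s
    ... | true  = ℚP.*-monoˡ-≤-nonNeg (prob s) {{nonNegative (prob-nonneg s)}} (toℚ-mono (D'≤D s))
    ... | false = ℚP.≤-refl

  worstCost-mono : ∀ {X Y} D' D → Y ⊆ X → (∀ s → pathCost I D' s ℕ.≤ pathCost I D s) →
    worstCost I Y D' ℕ.≤ worstCost I X D
  worstCost-mono {X} {Y} D' D Y⊆X D'≤D = maxFin-mono _ _ term
    where
    term : ∀ s → (if lookup Y s then pathCost I D' s else 0)
               ℕ.≤ (if lookup X s then pathCost I D s else 0)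
    term s with lookup Y s in s∈Y
    ... | false = z≤n
    ... | true rewrite []=⇒lookup (Y⊆X (lookup⇒[]= s Y s∈Y)) = D'≤D s

  expCost-partition : ∀ {q} (P : Fin q → Subset n) → IsPartition I P → ∀ D →
    sumFin (λ j → expCost I (P j) D) ≡ expCost I (full I) D
  expCost-partition P (_ , cover , disjoint) D =
    trans (sumFin-partition P cover disjoint weighted) (sumFin-cong _ _ on-full)
    where
    weighted : Fin n → ℚ
    weighted s = prob s * toℚ (pathCost I D s)
    on-full : ∀ s → weighted s ≡ (if lookup (full I) s then weighted s else 0ℚ)
    on-full s = cong (λ b → if b then weighted s else 0ℚ) (sym (lookup∘tabulate _ s))

  OPT-E-restrict : ∀ {X Y v D} → IsOPT-E I Y v → IsDT I X D → Y ⊆ X → v ≤ expCost I Y D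
  OPT-E-restrict {Y = Y} {D = D} (_ , v-optimal) D-tree Y⊆X with prune D-tree Y⊆X
  ... | D' , D'-tree , D'≤D = ℚP.≤-trans (v-optimal D' D'-tree) (expCost-mono Y D' D D'≤D)

  OPT-W-restrict : ∀ {X Y w D} → IsOPT-W I Y w → IsDT I X D → Y ⊆ X → w ℕ.≤ worstCost I X D
  OPT-W-restrict {D = D} (_ , w-optimal) D-tree Y⊆X with prune D-tree Y⊆X
  ... | D' , D'-tree , D'≤D = ℕP.≤-trans (w-optimal D' D'-tree) (worstCost-mono D' D Y⊆X D'≤D)

  in-full : ∀ {X} → X ⊆ full I
  in-full {x = s} _ = lookup⇒[]= s (full I) (lookup∘tabulate _ s)

proposition2 : (I : Instance) → (q : ℕ) → (P : Fin q → Subset (Instance.n I)) →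
    IsPartition I P →
    (∀ (v : ℚ) (vs : Fin q → ℚ) → IsOPT-E I (full I) v → (∀ j → IsOPT-E I (P j) (vs j)) →
    sumFin vs ≤ v)
    × (∀ (w : ℕ) (ws : Fin q → ℕ) → IsOPT-W I (full I) w → (∀ j → IsOPT-W I (P j) (ws j)) →
    maxFin ws Data.Nat.≤ w)
proposition2 I q P partition = expected , worst
  where
  expected : ∀ v (vs : Fin q → ℚ) → IsOPT-E I (full I) v → (∀ j → IsOPT-E I (P j) (vs j)) →
    sumFin vs ≤ v
  expected v vs ((D , D-tree , D≡v) , _) vs-opt =
    ℚP.≤-trans (sumFin-mono _ _ (λ j → OPT-E-restrict I (vs-opt j) D-tree (in-full I)))
               (ℚP.≤-reflexive (trans (expCost-partition I P partition D) D≡v))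

  worst : ∀ w (ws : Fin q → ℕ) → IsOPT-W I (full I) w → (∀ j → IsOPT-W I (P j) (ws j)) →
    maxFin ws ℕ.≤ w
  worst w ws ((D , D-tree , D≡w) , _) ws-opt =
    maxFin-lub ws w (λ j → ℕP.≤-trans (OPT-W-restrict I (ws-opt j) D-tree (in-full I))
                                       (ℕP.≤-reflexive D≡w))
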